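{- Let $G$ be a quiver with $n\geq 1$ vertices and without multiple connections, with Kirchhoff matrix $K$ whose smallest eigenvalue is $\lambda_1$, and let $d_1$ be the minimal vertex degree of $G$. Then $\lambda_1 \geq d_1 - (n-1)$.
   Context: A quiver $G=(V,E)$ consists of a finite vertex set $V=\{1,\dots,n\}$ and a finite list (multiset) of edges $E=\{(v_j,w_j)\in V\times V\}$, where repeated pairs and self-loops $(v,v)$ are allowed. "Without multiple connections" means that for any two distinct vertices $v\neq w$ there is at most one edge in the list equal to $(v,w)$ or $(w,v)$; self-loops (possibly several at the same vertex) are still allowed. The adjacency matrix $A$ has $A_{ij}$ ($i\neq j$) equal to the number of edges equal to $(i,j)$ or $(j,i)$ and $A_{ii}=0$. The degree of a vertex $v$ is the number of edges having $v$ as an endpoint, a self-loop at $v$ counting once; $B$ is the diagonal matrix of degrees and the Kirchhoff matrix is $K=B-A$. -}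

module Defs where

open import Level using (Level; _⊔_) renaming (suc to lsuc)
open import Data.Nat using (ℕ; zero; suc; _⊓_)
open import Data.Fin using (Fin; zero; suc)
open import Data.Fin.Properties using (_≟_)
open import Data.Product using (Σ; _×_; _,_; proj₁; proj₂; ∃; ∃-syntax)
open import Data.Sum using (_⊎_)
open import Data.List using (List; []; _∷_)
open import Relation.Nullary using (¬_; Dec; yes; no)
open import Relation.Nullary.Decidable using (_⊎-dec_; _×-dec_)
open import Relation.Binary.PropositionalEquality using (_≡_)
open import Relation.Binary.Structures using (IsTotalOrder)
open import Algebra.Bundles using (CommutativeRing)
import Data.Nat as ℕ

-- Quivers on the vertex set Fin n (vertices 1..n are 0..n-1 here).
-- Edges form a list (multiset); repeated pairs and self-loops allowed.

record Quiver (n : ℕ) : Set where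
  constructor quiver
  field
    edges : List (Fin n × Fin n)

open Quiver public

countL : {A : Set} {P : A → Set} → ((x : A) → Dec (P x)) → List A → ℕ
countL P? []       = 0
countL P? (x ∷ xs) with P? x
... | yes _ = suc (countL P? xs)
... | no  _ = countL P? xs

connections : {n : ℕ} → Quiver n → Fin n → Fin n → ℕ
connections G i j =
  countL (λ e → ((proj₁ e ≟ i) ×-dec (proj₂ e ≟ j)) ⊎-dec ((proj₁ e ≟ j) ×-dec (proj₂ e ≟ i)))
         (edges G)

NoMultipleConnections : {n : ℕ} → Quiver n → Set
NoMultipleConnections {n} G = (v w : Fin n) → ¬ (v ≡ w) → connections G v w ℕ.≤ 1

adjacency : {n : ℕ} → Quiver n → Fin n → Fin n → ℕ
adjacency G i j with i ≟ j
... | yes _ = 0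
... | no  _ = connections G i j

-- degree: number of edges having v as an endpoint (a self-loop counts once)
degree : {n : ℕ} → Quiver n → Fin n → ℕ
degree G v = countL (λ e → (proj₁ e ≟ v) ⊎-dec (proj₂ e ≟ v)) (edges G)

minOver : {m : ℕ} → (Fin (suc m) → ℕ) → ℕ
minOver {zero}  f = f zero
minOver {suc m} f = f zero ⊓ minOver (λ i → f (suc i))

minDegree : {m : ℕ} → Quiver (suc m) → ℕ
minDegree G = minOver (degree G)

-- Ordered fields (the stdlib has no reals; ℝ is one instance).

record OrderedField (c ℓ₁ ℓ₂ : Level) : Set (lsuc (c ⊔ ℓ₁ ⊔ ℓ₂)) where
  field
    commutativeRing : CommutativeRing c ℓ₁
  open CommutativeRing commutativeRing public
  field
    _≤_          : Carrier → Carrier → Set ℓ₂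
    isTotalOrder : IsTotalOrder _≈_ _≤_
    +-mono-≤     : ∀ {x y} z → x ≤ y → (x + z) ≤ (y + z)
    *-nonneg     : ∀ {x y} → 0# ≤ x → 0# ≤ y → 0# ≤ (x * y)
    0≉1          : ¬ (0# ≈ 1#)
    inverse      : ∀ x → ¬ (x ≈ 0#) → ∃[ y ] (x * y ≈ 1#)

module _ {c ℓ₁ ℓ₂ : Level} (F : OrderedField c ℓ₁ ℓ₂) where
  open OrderedField F using (Carrier; _≈_; _≤_; _+_; _*_; _-_; 0#; 1#)

  fromℕ : ℕ → Carrier
  fromℕ zero    = 0#
  fromℕ (suc k) = 1# + fromℕ k

  sumF : {n : ℕ} → (Fin n → Carrier) → Carrier
  sumF {zero}  f = 0#
  sumF {suc n} f = f zero + sumF (λ i → f (suc i))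

  kirchhoff : {n : ℕ} → Quiver n → Fin n → Fin n → Carrier
  kirchhoff G i j with i ≟ j
  ... | yes _ = fromℕ (degree G i) - fromℕ (adjacency G i j)
  ... | no  _ = 0# - fromℕ (adjacency G i j)

  IsEigenvalue : {n : ℕ} → (Fin n → Fin n → Carrier) → Carrier → Set (c ⊔ ℓ₁)
  IsEigenvalue {n} M λ′ =
    Σ (Fin n → Carrier) λ v → ((Σ (Fin n) λ i → ¬ (v i ≈ 0#)) ×
            ((i : Fin n) → sumF (λ j → M i j * v j) ≈ λ′ * v i))

  IsSmallestEigenvalue : {n : ℕ} → (Fin n → Fin n → Carrier) → Carrier → Set (c ⊔ ℓ₁ ⊔ ℓ₂)
  IsSmallestEigenvalue M λ′ =
    IsEigenvalue M λ′ × (∀ μ → IsEigenvalue M μ → λ′ ≤ μ)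

-- Take an eigenvector for μ, negated if necessary so that its largest
-- coordinate w i is positive. In row i of K w = μ w the diagonal term is
-- deg(i) · w i, and since G has no multiple connections each of the other
-- m terms is -w j or 0, hence at least -w i. So μ · w i ≥ (deg(i) - m) · w i,
-- and cancelling w i > 0 bounds every eigenvalue, a fortiori λ₁, from below
-- by deg(i) - m ≥ d₁ - m.

module Submission where

open import Defs
open import Level using (Level; _⊔_)
open import Data.Nat using (ℕ; zero; suc; z≤n; s≤s)
import Data.Nat as ℕ
import Data.Nat.Properties as ℕ
open import Data.Fin using (Fin; zero; suc)
open import Data.Fin.Properties using (_≟_; suc-injective)
open import Data.Product using (Σ; ∃; _,_)
open import Data.Sum using (_⊎_; inj₁; inj₂)
open import Data.Empty using (⊥-elim)
open import Relation.Nullary using (¬_; yes; no)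
open import Relation.Binary.Bundles using (Poset)
open import Relation.Binary.Structures using (IsTotalOrder)
open import Relation.Binary.PropositionalEquality as ≡ using (_≢_; ≢-sym)
import Algebra.Properties.Ring as RingProperties
import Relation.Binary.Reasoning.PartialOrder as PosetReasoning

minOver-≤ : {m : ℕ} (f : Fin (suc m) → ℕ) (i : Fin (suc m)) → minOver f ℕ.≤ f i
minOver-≤ {zero}  f zero    = ℕ.≤-refl
minOver-≤ {suc m} f zero    = ℕ.m⊓n≤m (f zero) _
minOver-≤ {suc m} f (suc i) = ℕ.≤-trans (ℕ.m⊓n≤n (f zero) _) (minOver-≤ (λ j → f (suc j)) i)

module OrderedFieldProperties {c ℓ₁ ℓ₂ : Level} (F : OrderedField c ℓ₁ ℓ₂) where

  open OrderedField F hiding (zero) renaming (+-mono-≤ to +-monoˡ-≤; _≤_ to infix 4 _≤_)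
  open IsTotalOrder isTotalOrder public
    using (total; antisym; ≤-respˡ-≈; ≤-respʳ-≈)
    renaming (refl to ≤-refl; reflexive to ≤-reflexive; trans to ≤-trans)
  open RingProperties ring

  poset : Poset c ℓ₁ ℓ₂
  poset = record { isPartialOrder = IsTotalOrder.isPartialOrder isTotalOrder }

  ≤-resp₂-≈ : ∀ {x x′ y y′} → x ≈ x′ → y ≈ y′ → x ≤ y → x′ ≤ y′
  ≤-resp₂-≈ x≈x′ y≈y′ x≤y = ≤-respˡ-≈ x≈x′ (≤-respʳ-≈ y≈y′ x≤y)

  +-monoʳ-≤ : ∀ {x y} z → x ≤ y → z + x ≤ z + y
  +-monoʳ-≤ z x≤y = ≤-resp₂-≈ (+-comm _ z) (+-comm _ z) (+-monoˡ-≤ z x≤y)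

  +-mono-≤ : ∀ {x y u v} → x ≤ y → u ≤ v → x + u ≤ y + v
  +-mono-≤ {y = y} {u} x≤y u≤v = ≤-trans (+-monoˡ-≤ u x≤y) (+-monoʳ-≤ y u≤v)

  x≤y⇒0≤y-x : ∀ {x y} → x ≤ y → 0# ≤ y - x
  x≤y⇒0≤y-x {x} x≤y = ≤-respˡ-≈ (-‿inverseʳ x) (+-monoˡ-≤ (- x) x≤y)

  0≤y-x⇒x≤y : ∀ {x y} → 0# ≤ y - x → x ≤ y
  0≤y-x⇒x≤y {x} {y} 0≤y-x = ≤-resp₂-≈ (+-identityˡ x) y-x+x≈y (+-monoˡ-≤ x 0≤y-x)
    where
    open import Relation.Binary.Reasoning.Setoid setoid
    y-x+x≈y : (y - x) + x ≈ y
    y-x+x≈y = begin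
      (y - x) + x   ≈⟨ +-assoc y (- x) x ⟩
      y + (- x + x) ≈⟨ +-congˡ (-‿inverseˡ x) ⟩
      y + 0#        ≈⟨ +-identityʳ y ⟩
      y             ∎

  neg-mono-≤ : ∀ {x y} → x ≤ y → - y ≤ - x
  neg-mono-≤ {x} {y} x≤y =
    0≤y-x⇒x≤y (≤-respʳ-≈ (trans (+-comm y (- x)) (+-congˡ (sym (-‿involutive y)))) (x≤y⇒0≤y-x x≤y))

  -- If 1 ≤ 0 then 0 ≤ -1, so 0 ≤ (-1)(-1) = 1 as well.
  0≤1 : 0# ≤ 1#
  0≤1 with total 0# 1#
  ... | inj₁ 0≤1 = 0≤1
  ... | inj₂ 1≤0 = ≤-respʳ-≈ (-1*-1≈1) (*-nonneg 0≤-1 0≤-1)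
    where
    0≤-1 : 0# ≤ - 1#
    0≤-1 = ≤-respˡ-≈ -0#≈0# (neg-mono-≤ 1≤0)
    -1*-1≈1 : - 1# * - 1# ≈ 1#
    -1*-1≈1 = trans (-1*x≈-x (- 1#)) (-‿involutive 1#)

  fromℕ-mono-≤ : ∀ {a b} → a ℕ.≤ b → fromℕ F a ≤ fromℕ F b
  fromℕ-mono-≤ {b = zero}  z≤n       = ≤-refl
  fromℕ-mono-≤ {b = suc b} z≤n       = ≤-respˡ-≈ (+-identityˡ 0#) (+-mono-≤ 0≤1 (fromℕ-mono-≤ {b = b} z≤n))
  fromℕ-mono-≤             (s≤s a≤b) = +-monoʳ-≤ 1# (fromℕ-mono-≤ a≤b)

  *-monoˡ-≤-nonNeg : ∀ {x y} z → 0# ≤ z → x ≤ y → x * z ≤ y * z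
  *-monoˡ-≤-nonNeg {x} {y} z 0≤z x≤y =
    0≤y-x⇒x≤y (≤-respʳ-≈ ([y-z]x≈yx-zx z y x) (*-nonneg (x≤y⇒0≤y-x x≤y) 0≤z))

  -- In the case y ≤ x, both products agree and z is invertible.
  *-cancelʳ-≤-pos : ∀ {x y} z → 0# ≤ z → ¬ (z ≈ 0#) → x * z ≤ y * z → x ≤ y
  *-cancelʳ-≤-pos {x} {y} z 0≤z z≉0 xz≤yz with total x y | inverse z z≉0
  ... | inj₁ x≤y | _ = x≤y
  ... | inj₂ y≤x | z⁻¹ , zz⁻¹≈1 = ≤-reflexive x≈y
    where
    open import Relation.Binary.Reasoning.Setoid setoid
    xz≈yz : x * z ≈ y * z
    xz≈yz = antisym xz≤yz (*-monoˡ-≤-nonNeg z 0≤z y≤x)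
    x≈y : x ≈ y
    x≈y = begin
      x              ≈⟨ sym (*-identityʳ x) ⟩
      x * 1#         ≈⟨ *-congˡ (sym zz⁻¹≈1) ⟩
      x * (z * z⁻¹)  ≈⟨ sym (*-assoc x z z⁻¹) ⟩
      (x * z) * z⁻¹  ≈⟨ *-congʳ xz≈yz ⟩
      (y * z) * z⁻¹  ≈⟨ *-assoc y z z⁻¹ ⟩
      y * (z * z⁻¹)  ≈⟨ *-congˡ zz⁻¹≈1 ⟩
      y * 1#         ≈⟨ *-identityʳ y ⟩
      y              ∎

  -x≤c*y : ∀ {c x y} → c ≈ 0# ⊎ c ≈ - 1# → 0# ≤ x → y ≤ x → - x ≤ c * y
  -x≤c*y {y = y} (inj₁ c≈0) 0≤x y≤x =
    ≤-resp₂-≈ refl (trans -0#≈0# (sym (trans (*-congʳ c≈0) (zeroˡ y)))) (neg-mono-≤ 0≤x)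
  -x≤c*y {y = y} (inj₂ c≈-1) 0≤x y≤x =
    ≤-respʳ-≈ (sym (trans (*-congʳ c≈-1) (-1*x≈-x y))) (neg-mono-≤ y≤x)

  fromℕ-suc-* : ∀ k a → fromℕ F (suc k) * a ≈ a + fromℕ F k * a
  fromℕ-suc-* k a = trans (distribʳ a 1# (fromℕ F k)) (+-congʳ (*-identityˡ a))

  sumF-cong : ∀ {k} {f g : Fin k → Carrier} → (∀ j → f j ≈ g j) → sumF F f ≈ sumF F g
  sumF-cong {zero}  f≈g = refl
  sumF-cong {suc k} f≈g = +-cong (f≈g zero) (sumF-cong (λ j → f≈g (suc j)))

  sumF-neg : ∀ {k} (f : Fin k → Carrier) → sumF F (λ j → - f j) ≈ - sumF F f
  sumF-neg {zero}  f = sym -0#≈0#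
  sumF-neg {suc k} f = trans (+-congˡ (sumF-neg (λ j → f (suc j)))) (-‿+-comm _ _)

  sumF-lowerBound : ∀ {k} (f : Fin k → Carrier) a → (∀ j → a ≤ f j) → fromℕ F k * a ≤ sumF F f
  sumF-lowerBound {zero}  f a a≤f = ≤-reflexive (zeroˡ a)
  sumF-lowerBound {suc k} f a a≤f =
    ≤-respˡ-≈ (sym (fromℕ-suc-* k a))
      (+-mono-≤ (a≤f zero) (sumF-lowerBound (λ j → f (suc j)) a (λ j → a≤f (suc j))))

  sumF-lowerBound-except : ∀ {m} (f : Fin (suc m) → Carrier) a i → (∀ j → j ≢ i → a ≤ f j) →
                           f i + fromℕ F m * a ≤ sumF F f
  sumF-lowerBound-except f a zero a≤f =
    +-monoʳ-≤ (f zero) (sumF-lowerBound (λ j → f (suc j)) a (λ j → a≤f (suc j) λ ()))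
  sumF-lowerBound-except {suc m} f a (suc i) a≤f =
    ≤-respˡ-≈ reassociate (+-mono-≤ (a≤f zero λ ()) lowerBound-tail)
    where
    open import Relation.Binary.Reasoning.Setoid setoid
    lowerBound-tail : f (suc i) + fromℕ F m * a ≤ sumF F (λ j → f (suc j))
    lowerBound-tail = sumF-lowerBound-except (λ j → f (suc j)) a i
                        (λ j j≢i → a≤f (suc j) (λ sj≡si → j≢i (suc-injective sj≡si)))
    reassociate : a + (f (suc i) + fromℕ F m * a) ≈ f (suc i) + fromℕ F (suc m) * a
    reassociate = begin
      a + (f (suc i) + fromℕ F m * a) ≈⟨ sym (+-assoc a _ _) ⟩
      (a + f (suc i)) + fromℕ F m * a ≈⟨ +-congʳ (+-comm a _) ⟩
      (f (suc i) + a) + fromℕ F m * a ≈⟨ +-assoc _ a _ ⟩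
      f (suc i) + (a + fromℕ F m * a) ≈⟨ +-congˡ (sym (fromℕ-suc-* m a)) ⟩
      f (suc i) + fromℕ F (suc m) * a ∎

  argmax : ∀ {m} (f : Fin (suc m) → Carrier) → Σ (Fin (suc m)) λ i → ∀ j → f j ≤ f i
  argmax {zero} f = zero , λ { zero → ≤-refl }
  argmax {suc m} f with argmax (λ j → f (suc j))
  ... | i , fsj≤fsi with total (f zero) (f (suc i))
  ... | inj₁ f0≤fsi = suc i , λ { zero → f0≤fsi ; (suc j) → fsj≤fsi j }
  ... | inj₂ fsi≤f0 = zero  , λ { zero → ≤-refl ; (suc j) → ≤-trans (fsj≤fsi j) fsi≤f0 }

module Eigenvalues {c ℓ₁ ℓ₂ : Level} (F : OrderedField c ℓ₁ ℓ₂) where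

  open OrderedField F hiding (zero; +-mono-≤) renaming (_≤_ to infix 4 _≤_)
  open OrderedFieldProperties F
  open RingProperties ring

  EigenEquation : {n : ℕ} → (Fin n → Fin n → Carrier) → Carrier → (Fin n → Carrier) → Set ℓ₁
  EigenEquation M μ w = ∀ i → sumF F (λ j → M i j * w j) ≈ μ * w i

  eigenEquation-neg : ∀ {n} {M : Fin n → Fin n → Carrier} {μ w} →
                      EigenEquation M μ w → EigenEquation M μ (λ j → - w j)
  eigenEquation-neg {M = M} {μ} {w} Mw≈μw i = begin
    sumF F (λ j → M i j * - w j)   ≈⟨ sumF-cong (λ j → sym (-‿distribʳ-* (M i j) (w j))) ⟩
    sumF F (λ j → - (M i j * w j)) ≈⟨ sumF-neg (λ j → M i j * w j) ⟩
    - sumF F (λ j → M i j * w j)   ≈⟨ -‿cong (Mw≈μw i) ⟩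
    - (μ * w i)                    ≈⟨ -‿distribʳ-* μ (w i) ⟩
    μ * - w i                      ∎
    where open import Relation.Binary.Reasoning.Setoid setoid

  record DominantEigenvector {m : ℕ} (M : Fin (suc m) → Fin (suc m) → Carrier) (μ : Carrier)
                             : Set (c ⊔ ℓ₁ ⊔ ℓ₂) where
    field
      vector      : Fin (suc m) → Carrier
      equation    : EigenEquation M μ vector
      top         : Fin (suc m)
      top-nonNeg  : 0# ≤ vector top
      top-nonZero : ¬ (vector top ≈ 0#)
      top-max     : ∀ j → vector j ≤ vector top

  dominantEigenvector-fromNonNeg : ∀ {m} {M : Fin (suc m) → Fin (suc m) → Carrier} {μ} w →
                                   EigenEquation M μ w → ∀ k → 0# ≤ w k → ¬ (w k ≈ 0#) →
                                   DominantEigenvector M μ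
  dominantEigenvector-fromNonNeg w Mw≈μw k 0≤wk wk≉0 with argmax w
  ... | i , wj≤wi = record
    { vector      = w
    ; equation    = Mw≈μw
    ; top         = i
    ; top-nonNeg  = ≤-trans 0≤wk (wj≤wi k)
    ; top-nonZero = λ wi≈0 → wk≉0 (antisym (≤-respʳ-≈ wi≈0 (wj≤wi k)) 0≤wk)
    ; top-max     = wj≤wi
    }

  dominantEigenvector : ∀ {m} {M : Fin (suc m) → Fin (suc m) → Carrier} {μ} →
                        IsEigenvalue F M μ → DominantEigenvector M μ
  dominantEigenvector {M = M} (v , (k , vk≉0) , Mv≈μv) with total 0# (v k)
  ... | inj₁ 0≤vk = dominantEigenvector-fromNonNeg v Mv≈μv k 0≤vk vk≉0
  ... | inj₂ vk≤0 = dominantEigenvector-fromNonNeg (λ j → - v j) (eigenEquation-neg {M = M} Mv≈μv) k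
                      (≤-respˡ-≈ -0#≈0# (neg-mono-≤ vk≤0))
                      (λ -vk≈0 → vk≉0 (trans (sym (-‿involutive (v k))) (trans (-‿cong -vk≈0) -0#≈0#)))

module KirchhoffProperties {c ℓ₁ ℓ₂ : Level} (F : OrderedField c ℓ₁ ℓ₂) where

  open OrderedField F hiding (zero; +-mono-≤) renaming (_≤_ to infix 4 _≤_)
  open OrderedFieldProperties F
  open Eigenvalues F
  open RingProperties ring

  kirchhoff-diag : ∀ {n} (G : Quiver n) i → kirchhoff F G i i ≈ fromℕ F (degree G i)
  kirchhoff-diag G i with i ≟ i
  ... | no i≢i = ⊥-elim (i≢i ≡.refl)
  ... | yes _ with i ≟ i
  ...   | yes _ = trans (+-congˡ -0#≈0#) (+-identityʳ _)
  ...   | no i≢i = ⊥-elim (i≢i ≡.refl)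

  kirchhoff-offdiag : ∀ {n} (G : Quiver n) → NoMultipleConnections G → ∀ {i j} → i ≢ j →
                      kirchhoff F G i j ≈ 0# ⊎ kirchhoff F G i j ≈ - 1#
  kirchhoff-offdiag G noMult {i} {j} i≢j with i ≟ j
  ... | yes i≡j = ⊥-elim (i≢j i≡j)
  ... | no _ with i ≟ j
  ...   | yes i≡j = ⊥-elim (i≢j i≡j)
  ...   | no _ with connections G i j | noMult i j i≢j
  ...     | zero     | _ = inj₁ (-‿inverseʳ 0#)
  ...     | suc zero | _ = inj₂ (trans (+-identityˡ _) (-‿cong (+-identityʳ 1#)))
  ...     | suc (suc _) | s≤s ()

  kirchhoff-eigenvalue-lowerBound : ∀ {m} (G : Quiver (suc m)) → NoMultipleConnections G →
                                    ∀ {μ} → IsEigenvalue F (kirchhoff F G) μ →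
                                    ∃ λ i → fromℕ F (degree G i) - fromℕ F m ≤ μ
  kirchhoff-eigenvalue-lowerBound {m} G noMult {μ} isEigenvalue =
    i , *-cancelʳ-≤-pos (w i) top-nonNeg top-nonZero row-i
    where
    open DominantEigenvector (dominantEigenvector {M = kirchhoff F G} isEigenvalue)
      renaming (vector to w; top to i)
    K = kirchhoff F G
    d = fromℕ F (degree G i)
    open PosetReasoning poset
    offdiag-≥ : ∀ j → j ≢ i → - w i ≤ K i j * w j
    offdiag-≥ j j≢i = -x≤c*y (kirchhoff-offdiag G noMult (≢-sym j≢i)) top-nonNeg (top-max j)
    row-i : (d - fromℕ F m) * w i ≤ μ * w i
    row-i = begin
      (d - fromℕ F m) * w i            ≈⟨ [y-z]x≈yx-zx (w i) d (fromℕ F m) ⟩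
      d * w i - fromℕ F m * w i        ≈⟨ +-cong (*-congʳ (sym (kirchhoff-diag G i))) (-‿distribʳ-* (fromℕ F m) (w i)) ⟩
      K i i * w i + fromℕ F m * - w i  ≤⟨ sumF-lowerBound-except (λ j → K i j * w j) (- w i) i offdiag-≥ ⟩
      sumF F (λ j → K i j * w j)       ≈⟨ equation i ⟩
      μ * w i                          ∎

lemma2 : {c ℓ₁ ℓ₂ : Level} (F : OrderedField c ℓ₁ ℓ₂) (m : ℕ) (G : Quiver (suc m)) →
         NoMultipleConnections G →
         (λ₁ : OrderedField.Carrier F) →
         IsSmallestEigenvalue F (kirchhoff F G) λ₁ →
         OrderedField._≤_ F (OrderedField._-_ F (fromℕ F (minDegree G)) (fromℕ F m)) λ₁
lemma2 F m G noMult λ₁ (isEigenvalue , _)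
  with KirchhoffProperties.kirchhoff-eigenvalue-lowerBound F G noMult isEigenvalue
... | i , degᵢ-m≤λ₁ =
  ≤-trans (+-monoˡ-≤ (- fromℕ F m) (fromℕ-mono-≤ (minOver-≤ (degree G) i))) degᵢ-m≤λ₁
  where
  open OrderedField F using (-_) renaming (+-mono-≤ to +-monoˡ-≤)
  open OrderedFieldProperties F using (≤-trans; fromℕ-mono-≤)
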